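{- If $\varphi$ is a modal formula (resp. a black modal formula or a bimodal formula), $\underline{B}$ a subordination algebra and $\theta$ a congruence (resp. a black congruence or a strong congruence), then \[ \underline{B}\models\varphi \ \Rightarrow\ \underline{B/_\theta}\models\varphi. \] In other words, validity of a formula is preserved by morphic images (surjective morphisms of the kind corresponding to its language).
   Context: Subordination algebra: $(B,\prec)$, $B$ Boolean, each $\prec(b,-)$ a filter and each $\prec(-,b)$ an ideal. For a Boolean homomorphism $f:B\to C$ between subordination algebras consider: (w) $a\prec b$ implies $f(a)\prec f(b)$; (white) $f(a)\prec c$ implies $a\prec b$ and $f(b)\leq c$ for some $b$; (black) $c\prec f(a)$ implies $b\prec a$ and $c\leq f(b)$ for some $b$. Morphisms satisfy (w) and (white), black morphisms satisfy (w) and (black), strong morphisms satisfy all three. A congruence (resp. black congruence, strong congruence) on $\underline{B}$ is a Boolean congruence that is the kernel of a morphism (resp. black morphism, strong morphism); $\underline{B/_\theta}$ is the quotient subordination algebra, i.e. the Boolean quotient with the subordination making the canonical projection a morphism of the corresponding kind (for white congruences, $a^\theta\prec^\theta b^\theta$ iff $a\prec c\mathrel{\theta}b$ for some $c$). Modal (white) formulas use $\lozenge$ (and $\square$) only, black modal formulas use only the black diamond (written here $\lozenge^{ - }$) and its dual, bimodal formulas use both. Formulas are evaluated, for valuations into $B$, in the canonical extension $\mathcal{P}(\mathrm{Ult}(B))$ with $\lozenge E=R(-,E)$, $\lozenge^{ - }E=R(E,-)$, where $x\mathrel{R}y$ iff $\prec(y,-)\subseteq x$; $\underline{B}\models\varphi$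 means $\varphi$ evaluates to the top under all valuations. -}

module Defs where

open import Level using (Level; _⊔_; suc)
open import Data.Nat using (ℕ)
open import Data.Product using (Σ; _×_; ∃; ∃-syntax)
open import Data.Sum using (_⊎_)
import Data.Unit.Polymorphic as U
import Data.Empty.Polymorphic as E
import Relation.Nullary as N
open import Relation.Binary using (Rel; IsEquivalence)
open import Function.Bundles using (_⇔_)
open import Algebra.Lattice.Bundles using (BooleanAlgebra)

-- Used to talk
-- about ultrafilters and the canonical-extension semantics of both a
-- subordination algebra and its quotient B/θ (same operations, equality θ).

record BSig (c e : Level) : Set (suc (c ⊔ e)) where
  field
    Carrier : Set c
    _≈_     : Rel Carrier e
    _∧_ _∨_ : Carrier → Carrier → Carrier
    ¬ᵇ_     : Carrier → Carrier
    ⊤ᵇ ⊥ᵇ   : Carrier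

  _≤_ : Rel Carrier e
  a ≤ b = (a ∧ b) ≈ a

sigOf : ∀ {c ℓ} → BooleanAlgebra c ℓ → BSig c ℓ
sigOf B = record
  { Carrier = Carrier ; _≈_ = _≈_ ; _∧_ = _∧_ ; _∨_ = _∨_
  ; ¬ᵇ_ = ¬_ ; ⊤ᵇ = ⊤ ; ⊥ᵇ = ⊥ }
  where open BooleanAlgebra B

record SubAlg (c ℓ r : Level) : Set (suc (c ⊔ ℓ ⊔ r)) where
  field
    B   : BooleanAlgebra c ℓ
  open BooleanAlgebra B public
  _≤ᵇ_ : Rel Carrier ℓ
  a ≤ᵇ b = (a ∧ b) ≈ a
  field
    _≺_ : Rel Carrier r
    ≺-⊤    : ∀ a → a ≺ ⊤
    ≺-∧    : ∀ {a b b'} → a ≺ b → a ≺ b' → a ≺ (b ∧ b')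
    ≺-up   : ∀ {a b b'} → a ≺ b → b ≤ᵇ b' → a ≺ b'
    ≺-⊥    : ∀ b → ⊥ ≺ b
    ≺-∨    : ∀ {a a' b} → a ≺ b → a' ≺ b → (a ∨ a') ≺ b
    ≺-down : ∀ {a a' b} → a ≺ b → a' ≤ᵇ a → a' ≺ b

record Ultrafilter {c e} (S : BSig c e) : Set (suc (c ⊔ e)) where
  open BSig S
  field
    _∈U    : Carrier → Set (c ⊔ e)
    ⊤∈     : ⊤ᵇ ∈U
    ∧∈     : ∀ {a b} → a ∈U → b ∈U → (a ∧ b) ∈U
    up∈    : ∀ {a b} → a ∈U → a ≤ b → b ∈U
    ⊥∉     : N.¬ (⊥ᵇ ∈U)
    ultra  : ∀ a → a ∈U ⊎ (¬ᵇ a) ∈U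

R : ∀ {c e r} (S : BSig c e) (_≺_ : Rel (BSig.Carrier S) r) →
    Ultrafilter S → Ultrafilter S → Set (c ⊔ e ⊔ r)
R S _≺_ x y = ∀ a b → Ultrafilter._∈U y a → a ≺ b → Ultrafilter._∈U x b

data Kind : Set where
  white black strong : Kind     -- strong ↔ bimodal language

data HasWhite : Kind → Set where
  w-white : HasWhite white
  w-strong : HasWhite strong

data HasBlack : Kind → Set where
  b-black : HasBlack black
  b-strong : HasBlack strong

data Formula (k : Kind) : Set where
  var      : ℕ → Formula k
  ⊤f ⊥f    : Formula k
  ¬f_      : Formula k → Formula k
  _∧f_ _∨f_ : Formula k → Formula k → Formula k
  ◇        : HasWhite k → Formula k → Formula k
  ◇⁻       : HasBlack k → Formula k → Formula k

_⇒f_ : ∀ {k} → Formula k → Formula k → Formula k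
φ ⇒f ψ = (¬f φ) ∨f ψ

□ : ∀ {k} → HasWhite k → Formula k → Formula k
□ h φ = ¬f (◇ h (¬f φ))

□⁻ : ∀ {k} → HasBlack k → Formula k → Formula k
□⁻ h φ = ¬f (◇⁻ h (¬f φ))

⟦_⟧ : ∀ {k c e r} {S : BSig c e} {_≺_ : Rel (BSig.Carrier S) r} →
      Formula k → (ℕ → BSig.Carrier S) →
      Ultrafilter S → Set (suc (c ⊔ e) ⊔ r)
⟦_⟧ {S = S} {_≺_} (var p) v x = Level.Lift _ (Ultrafilter._∈U x (v p))
⟦ ⊤f ⟧ v x = U.⊤
⟦ ⊥f ⟧ v x = E.⊥
⟦_⟧ {S = S} {_≺_} (¬f φ) v x = N.¬ ⟦_⟧ {S = S} {_≺_} φ v x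
⟦_⟧ {S = S} {_≺_} (φ ∧f ψ) v x = ⟦_⟧ {S = S} {_≺_} φ v x × ⟦_⟧ {S = S} {_≺_} ψ v x
⟦_⟧ {S = S} {_≺_} (φ ∨f ψ) v x = ⟦_⟧ {S = S} {_≺_} φ v x ⊎ ⟦_⟧ {S = S} {_≺_} ψ v x
⟦_⟧ {S = S} {_≺_} (◇ _ φ) v x = ∃[ y ] (R S _≺_ x y × ⟦_⟧ {S = S} {_≺_} φ v y)
⟦_⟧ {S = S} {_≺_} (◇⁻ _ φ) v y = ∃[ x ] (⟦_⟧ {S = S} {_≺_} φ v x × R S _≺_ x y)

Valid : ∀ {k c e r} (S : BSig c e) (_≺_ : Rel (BSig.Carrier S) r) → Formula k → Set (suc (c ⊔ e) ⊔ r)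
Valid S _≺_ φ = ∀ (v : ℕ → BSig.Carrier S) (x : Ultrafilter S) → ⟦_⟧ {S = S} {_≺_} φ v x

_⊨_ : ∀ {k c ℓ r} → SubAlg c ℓ r → Formula k → Set (suc (c ⊔ ℓ) ⊔ r)
A ⊨ φ = Valid (sigOf (SubAlg.B A)) (SubAlg._≺_ A) φ

record BoolHom {c ℓ r c' ℓ' r'} (A : SubAlg c ℓ r) (C : SubAlg c' ℓ' r')
       : Set (c ⊔ ℓ ⊔ c' ⊔ ℓ') where
  private
    module A = SubAlg A
    module C = SubAlg C
  field
    f     : A.Carrier → C.Carrier
    cong  : ∀ {a b} → a A.≈ b → f a C.≈ f b
    ∧-hom : ∀ a b → f (a A.∧ b) C.≈ (f a C.∧ f b)
    ∨-hom : ∀ a b → f (a A.∨ b) C.≈ (f a C.∨ f b)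
    ¬-hom : ∀ a → f (A.¬ a) C.≈ C.¬ (f a)
    ⊤-hom : f A.⊤ C.≈ C.⊤
    ⊥-hom : f A.⊥ C.≈ C.⊥

module _ {c ℓ r c' ℓ' r'} {A : SubAlg c ℓ r} {C : SubAlg c' ℓ' r'} (h : BoolHom A C) where
  private
    module A = SubAlg A
    module C = SubAlg C
  open BoolHom h

  CondW : Set (c ⊔ r ⊔ r')
  CondW = ∀ {a b} → a A.≺ b → f a C.≺ f b

  CondWhite : Set (c ⊔ ℓ' ⊔ r ⊔ c' ⊔ r')
  CondWhite = ∀ {a c} → f a C.≺ c → ∃[ b ] (a A.≺ b × f b C.≤ᵇ c)

  CondBlack : Set (c ⊔ ℓ' ⊔ r ⊔ c' ⊔ r')
  CondBlack = ∀ {a c} → c C.≺ f a → ∃[ b ] (b A.≺ a × c C.≤ᵇ f b)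

  IsMorphismOf : Kind → Set (c ⊔ ℓ' ⊔ r ⊔ c' ⊔ r')
  IsMorphismOf white  = CondW × CondWhite
  IsMorphismOf black  = CondW × CondBlack
  IsMorphismOf strong = CondW × CondWhite × CondBlack

record BoolCongruence {c ℓ r} (A : SubAlg c ℓ r) (t : Level) : Set (c ⊔ ℓ ⊔ suc t) where
  open SubAlg A
  field
    θ       : Rel Carrier t
    isEquiv : IsEquivalence θ
    ≈⇒θ     : ∀ {a b} → a ≈ b → θ a b
    ∧-cong  : ∀ {a a' b b'} → θ a a' → θ b b' → θ (a ∧ b) (a' ∧ b')
    ∨-cong  : ∀ {a a' b b'} → θ a a' → θ b b' → θ (a ∨ b) (a' ∨ b')
    ¬-cong  : ∀ {a a'} → θ a a' → θ (¬ a) (¬ a')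

-- θ is a congruence of kind k (white congruence / black congruence /
-- strong congruence): θ is the kernel of a morphism of kind k into some
-- subordination algebra C.
IsKernelOfKind : ∀ {c ℓ r t} (k : Kind) (c' ℓ' r' : Level) (A : SubAlg c ℓ r) →
                 BoolCongruence A t → Set (c ⊔ ℓ ⊔ r ⊔ t ⊔ suc (c' ⊔ ℓ' ⊔ r'))
IsKernelOfKind k c' ℓ' r' A Θ =
  Σ (SubAlg c' ℓ' r') λ C → Σ (BoolHom A C) λ g →
    IsMorphismOf g k × (∀ a b → BoolCongruence.θ Θ a b ⇔ SubAlg._≈_ C (BoolHom.f g a) (BoolHom.f g b))

quotSig : ∀ {c ℓ r t} (A : SubAlg c ℓ r) → BoolCongruence A t → BSig c t
quotSig A Θ = record
  { Carrier = Carrier ; _≈_ = BoolCongruence.θ Θ ; _∧_ = _∧_ ; _∨_ = _∨_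
  ; ¬ᵇ_ = ¬_ ; ⊤ᵇ = ⊤ ; ⊥ᵇ = ⊥ }
  where open SubAlg A

-- the quotient subordination ≺^θ (making the projection a morphism of kind k)
quotRel : ∀ {c ℓ r t} (k : Kind) (A : SubAlg c ℓ r) → BoolCongruence A t →
          Rel (SubAlg.Carrier A) (c ⊔ r ⊔ t)
quotRel white  A Θ a b = ∃[ c ] (SubAlg._≺_ A a c × BoolCongruence.θ Θ c b)
quotRel black  A Θ a b = ∃[ c ] (BoolCongruence.θ Θ a c × SubAlg._≺_ A c b)
quotRel strong A Θ a b =
  ∃[ a' ] ∃[ b' ] (BoolCongruence.θ Θ a a' × SubAlg._≺_ A a' b' × BoolCongruence.θ Θ b' b)

_/_⊨_ : ∀ {k c ℓ r t} (A : SubAlg c ℓ r) → BoolCongruence A t → Formula k →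
        Set (suc (c ⊔ t) ⊔ r)
_/_⊨_ {k} A Θ φ = Valid (quotSig A Θ) (quotRel k A Θ) φ

-- Ultrafilters of B/θ are the θ-saturated ultrafilters of B, and having the same
-- members is a bisimulation between the canonical frames of B/θ and B, so points
-- related by it satisfy the same formulas. Steps of B/θ lift to B because ≺ ⊆ ≺^θ.
-- Steps of B descend to B/θ once the ultrafilter reached from a saturated one is
-- itself saturated, i.e. contains no θ-null element. For a white kernel a θ-null d
-- satisfies d ≺ e with e θ-null, and e would lie in the saturated starting point;
-- for a black kernel ¬d is θ-full, hence b ≺ ¬d for a θ-full b, and b in the
-- saturated starting point forces ¬d into the ultrafilter containing d.
module Submission where

open import Defs
open import Level using (Lift; lift; lower; _⊔_)
open import Data.Empty using (⊥-elim)
open import Data.Nat using (ℕ)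
open import Data.Product using (_×_; _,_; ∃-syntax)
open import Data.Product.Function.NonDependent.Propositional using (_×-⇔_)
open import Data.Sum as Sum using (_⊎_; inj₁; inj₂)
open import Data.Sum.Function.Propositional using (_⊎-⇔_)
open import Function.Base using (_∘_)
open import Function.Bundles using (_⇔_; mk⇔; Equivalence)
open import Function.Construct.Symmetry using (⇔-sym)
open import Function.Related.TypeIsomorphisms using (¬-cong-⇔)
open import Relation.Binary using (Rel; IsEquivalence)
open import Relation.Nullary using (¬_; Dec; yes; no)
open import Relation.Nullary.Decidable using (True; toWitness; fromWitness)
import Algebra.Lattice.Properties.BooleanAlgebra as BooleanAlgebraProperties

_∈_ : ∀ {c e} {S : BSig c e} → BSig.Carrier S → Ultrafilter S → Set (c ⊔ e)
a ∈ x = Ultrafilter._∈U x a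

record IsUltrafilterPredicate {c e p} (S : BSig c e) (P : BSig.Carrier S → Set p)
       : Set (c ⊔ e ⊔ p) where
  open BSig S
  field
    ⊤∈          : P ⊤ᵇ
    ∧∈          : ∀ {a b} → P a → P b → P (a ∧ b)
    up∈         : ∀ {a b} → P a → a ≤ b → P b
    ⊥∉          : ¬ P ⊥ᵇ
    ultra       : ∀ a → P a ⊎ P (¬ᵇ a)
    complement∉ : ∀ {a} → P a → ¬ P (¬ᵇ a)

  decide : ∀ a → Dec (P a)
  decide a with ultra a
  ... | inj₁ pa  = yes pa
  ... | inj₂ p¬a = no λ pa → complement∉ pa p¬a

  -- Membership is re-encoded through the decision so that it lives at the
  -- level c ⊔ e demanded by Ultrafilter S, whatever the level of P.
  private
    Member : BSig.Carrier S → Set (c ⊔ e)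
    Member a = Lift (c ⊔ e) (True (decide a))

    member⇔ : ∀ a → Member a ⇔ P a
    member⇔ a = mk⇔ (toWitness ∘ lower) (lift ∘ fromWitness)

    open module Member⇔ {a} = Equivalence (member⇔ a)

  toUltrafilter : Ultrafilter S
  toUltrafilter = record
    { _∈U   = Member
    ; ⊤∈    = from ⊤∈
    ; ∧∈    = λ m n → from (∧∈ (to m) (to n))
    ; up∈   = λ m a≤b → from (up∈ (to m) a≤b)
    ; ⊥∉    = ⊥∉ ∘ to
    ; ultra = λ a → Sum.map from from (ultra a)
    }

  ∈-toUltrafilter : ∀ a → a ∈ toUltrafilter ⇔ P a
  ∈-toUltrafilter = member⇔

module _ {c e r c' e' r'} {S : BSig c e} {_≺_ : Rel (BSig.Carrier S) r}
         {T : BSig c' e'} {_⊏_ : Rel (BSig.Carrier T) r'} where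

  private
    ⟦_⟧ˢ : ∀ {k} → Formula k → (ℕ → BSig.Carrier S) → Ultrafilter S → Set (Level.suc (c ⊔ e) ⊔ r)
    ⟦ φ ⟧ˢ = ⟦_⟧ {S = S} {_≺_} φ

    ⟦_⟧ᵀ : ∀ {k} → Formula k → (ℕ → BSig.Carrier T) → Ultrafilter T → Set (Level.suc (c' ⊔ e') ⊔ r')
    ⟦ φ ⟧ᵀ = ⟦_⟧ {S = T} {_⊏_} φ

  record IsBisimulation {z} (k : Kind) (Z : Ultrafilter S → Ultrafilter T → Set z)
         (v : ℕ → BSig.Carrier S) (w : ℕ → BSig.Carrier T)
         : Set (Level.suc (c ⊔ e ⊔ c' ⊔ e') ⊔ r ⊔ r' ⊔ z) where
    field
      atoms : ∀ {x y} p → Z x y → v p ∈ x ⇔ w p ∈ y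
      zig   : HasWhite k → ∀ {x y x₁} → Z x y → R S _≺_ x x₁ → ∃[ y₁ ] (R T _⊏_ y y₁ × Z x₁ y₁)
      zag   : HasWhite k → ∀ {x y y₁} → Z x y → R T _⊏_ y y₁ → ∃[ x₁ ] (R S _≺_ x x₁ × Z x₁ y₁)
      zig⁻  : HasBlack k → ∀ {x y x₁} → Z x y → R S _≺_ x₁ x → ∃[ y₁ ] (R T _⊏_ y₁ y × Z x₁ y₁)
      zag⁻  : HasBlack k → ∀ {x y y₁} → Z x y → R T _⊏_ y₁ y → ∃[ x₁ ] (R S _≺_ x₁ x × Z x₁ y₁)

  ⟦⟧-bisimilar : ∀ {k z Z v w} → IsBisimulation {z} k Z v w →
                 ∀ φ {x y} → Z x y → ⟦ φ ⟧ˢ v x ⇔ ⟦ φ ⟧ᵀ w y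
  ⟦⟧-bisimilar {Z = Z} {v} {w} bisim = go
    where
      open IsBisimulation bisim
      go : ∀ φ {x y} → Z x y → ⟦ φ ⟧ˢ v x ⇔ ⟦ φ ⟧ᵀ w y
      go (var p)   xZy = mk⇔ (lift ∘ Equivalence.to (atoms p xZy) ∘ lower)
                             (lift ∘ Equivalence.from (atoms p xZy) ∘ lower)
      go ⊤f        xZy = mk⇔ _ _
      go ⊥f        xZy = mk⇔ (λ { (lift ()) }) (λ { (lift ()) })
      go (¬f φ)    xZy = ¬-cong-⇔ (go φ xZy)
      go (φ ∧f ψ)  xZy = go φ xZy ×-⇔ go ψ xZy
      go (φ ∨f ψ)  xZy = go φ xZy ⊎-⇔ go ψ xZy
      go (◇ h φ)   xZy = mk⇔
        (λ { (x₁ , xRx₁ , sat) → let (y₁ , yRy₁ , x₁Zy₁) = zig h xZy xRx₁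
                                 in y₁ , yRy₁ , Equivalence.to (go φ x₁Zy₁) sat })
        (λ { (y₁ , yRy₁ , sat) → let (x₁ , xRx₁ , x₁Zy₁) = zag h xZy yRy₁
                                 in x₁ , xRx₁ , Equivalence.from (go φ x₁Zy₁) sat })
      go (◇⁻ h φ)  xZy = mk⇔
        (λ { (x₁ , sat , x₁Rx) → let (y₁ , y₁Ry , x₁Zy₁) = zig⁻ h xZy x₁Rx
                                 in y₁ , Equivalence.to (go φ x₁Zy₁) sat , y₁Ry })
        (λ { (y₁ , sat , y₁Ry) → let (x₁ , x₁Rx , x₁Zy₁) = zag⁻ h xZy y₁Ry
                                 in x₁ , Equivalence.from (go φ x₁Zy₁) sat , x₁Rx })

isMorphism⇒CondWhite : ∀ {c ℓ r c' ℓ' r' k} {A : SubAlg c ℓ r} {C : SubAlg c' ℓ' r'} {g : BoolHom A C} →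
                       HasWhite k → IsMorphismOf g k → CondWhite g
isMorphism⇒CondWhite w-white  (_ , whiteCond)     = whiteCond
isMorphism⇒CondWhite w-strong (_ , whiteCond , _) = whiteCond

isMorphism⇒CondBlack : ∀ {c ℓ r c' ℓ' r' k} {A : SubAlg c ℓ r} {C : SubAlg c' ℓ' r'} {g : BoolHom A C} →
                       HasBlack k → IsMorphismOf g k → CondBlack g
isMorphism⇒CondBlack b-black  (_ , blackCond)     = blackCond
isMorphism⇒CondBlack b-strong (_ , _ , blackCond) = blackCond

module Quotient {c ℓ r t} (A : SubAlg c ℓ r) (Θ : BoolCongruence A t) where
  open SubAlg A renaming (¬_ to ¬ᵇ_; ⊤ to ⊤ᵇ; ⊥ to ⊥ᵇ)
  open BooleanAlgebraProperties B using (∧-idem; ∧-zeroʳ; ¬⊥≈⊤)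
  module Θ = BoolCongruence Θ
  open Θ using (θ)
  open IsEquivalence Θ.isEquiv renaming (refl to θ-refl; sym to θ-sym; trans to θ-trans)

  S : BSig c ℓ
  S = sigOf B

  Q : BSig c t
  Q = quotSig A Θ

  θ-resp-∈ : ∀ (x : Ultrafilter Q) {a b} → a ∈ x → θ a b → b ∈ x
  θ-resp-∈ x {a} a∈x ab =
    Ultrafilter.up∈ x a∈x (θ-trans (Θ.∧-cong θ-refl (θ-sym ab)) (Θ.≈⇒θ (∧-idem a)))

  complement∉ : ∀ (y : Ultrafilter S) {a} → a ∈ y → ¬ (¬ᵇ a) ∈ y
  complement∉ y {a} a∈y ¬a∈y = Ultrafilter.⊥∉ y
    (Ultrafilter.up∈ y (Ultrafilter.∧∈ y a∈y ¬a∈y) (trans (∧-zeroʳ _) (sym (∧-complementʳ a))))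

  Saturated : Ultrafilter S → Set (c ⊔ ℓ ⊔ t)
  Saturated y = ∀ {a b} → a ∈ y → θ a b → b ∈ y

  saturated-if-no-null : ∀ (y : Ultrafilter S) → (∀ {d} → d ∈ y → ¬ θ d ⊥ᵇ) → Saturated y
  saturated-if-no-null y no-null {a} {b} a∈y ab with Ultrafilter.ultra y b
  ... | inj₁ b∈y  = b∈y
  ... | inj₂ ¬b∈y = ⊥-elim (no-null (Ultrafilter.∧∈ y a∈y ¬b∈y)
                      (θ-trans (Θ.∧-cong ab θ-refl) (Θ.≈⇒θ (∧-complementʳ b))))

  preimage-isUltrafilterPredicate : ∀ (x : Ultrafilter Q) → IsUltrafilterPredicate S (_∈ x)
  preimage-isUltrafilterPredicate x = record
    { ⊤∈          = Ultrafilter.⊤∈ x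
    ; ∧∈          = Ultrafilter.∧∈ x
    ; up∈         = λ a∈x a≤b → Ultrafilter.up∈ x a∈x (Θ.≈⇒θ a≤b)
    ; ⊥∉          = Ultrafilter.⊥∉ x
    ; ultra       = Ultrafilter.ultra x
    ; complement∉ = λ {a} a∈x ¬a∈x → Ultrafilter.⊥∉ x
        (θ-resp-∈ x (Ultrafilter.∧∈ x a∈x ¬a∈x) (Θ.≈⇒θ (∧-complementʳ a)))
    }

  image-isUltrafilterPredicate : ∀ (y : Ultrafilter S) → Saturated y → IsUltrafilterPredicate Q (_∈ y)
  image-isUltrafilterPredicate y saturated = record
    { ⊤∈          = Ultrafilter.⊤∈ y
    ; ∧∈          = Ultrafilter.∧∈ y
    ; up∈         = λ {a} {b} a∈y a≤b → Ultrafilter.up∈ y (saturated a∈y (θ-sym a≤b))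
                      (trans (∧-assoc a b b) (∧-congˡ (∧-idem b)))
    ; ⊥∉          = Ultrafilter.⊥∉ y
    ; ultra       = Ultrafilter.ultra y
    ; complement∉ = complement∉ y
    }

  preimage : Ultrafilter Q → Ultrafilter S
  preimage x = IsUltrafilterPredicate.toUltrafilter (preimage-isUltrafilterPredicate x)

  image : (y : Ultrafilter S) → Saturated y → Ultrafilter Q
  image y saturated = IsUltrafilterPredicate.toUltrafilter (image-isUltrafilterPredicate y saturated)

  record Corresponds (y : Ultrafilter S) (x : Ultrafilter Q) : Set (c ⊔ ℓ ⊔ t) where
    constructor same-members
    field
      members : ∀ a → a ∈ y ⇔ a ∈ x

  preimage-corresponds : ∀ x → Corresponds (preimage x) x
  preimage-corresponds x =
    same-members (IsUltrafilterPredicate.∈-toUltrafilter (preimage-isUltrafilterPredicate x))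

  image-corresponds : ∀ y (saturated : Saturated y) → Corresponds y (image y saturated)
  image-corresponds y saturated = same-members λ a →
    ⇔-sym (IsUltrafilterPredicate.∈-toUltrafilter (image-isUltrafilterPredicate y saturated) a)

  ≺⇒quotRel : ∀ k {a b} → a ≺ b → quotRel k A Θ a b
  ≺⇒quotRel white  {a} {b} a≺b = b , a≺b , θ-refl
  ≺⇒quotRel black  {a} {b} a≺b = a , θ-refl , a≺b
  ≺⇒quotRel strong {a} {b} a≺b = a , b , θ-refl , a≺b , θ-refl

  R-quotient⇒R : ∀ k {x' x y' y} → Corresponds x' x → Corresponds y' y →
                 R Q (quotRel k A Θ) x y → R S _≺_ x' y'
  R-quotient⇒R k (same-members x'x) (same-members y'y) xRy a b a∈y' a≺b =
    Equivalence.from (x'x b) (xRy a b (Equivalence.to (y'y a) a∈y') (≺⇒quotRel k a≺b))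

  R⇒R-quotient : ∀ k {x' x y' y} → Corresponds x' x → Corresponds y' y →
                 R S _≺_ x' y' → R Q (quotRel k A Θ) x y
  R⇒R-quotient white {x = x} (same-members x'x) (same-members y'y) x'Ry' a b a∈y
               (a' , a≺a' , a'b) =
    θ-resp-∈ x (Equivalence.to (x'x a') (x'Ry' a a' (Equivalence.from (y'y a) a∈y) a≺a')) a'b
  R⇒R-quotient black {y = y} (same-members x'x) (same-members y'y) x'Ry' a b a∈y
               (a' , aa' , a'≺b) =
    Equivalence.to (x'x b) (x'Ry' a' b (Equivalence.from (y'y a') (θ-resp-∈ y a∈y aa')) a'≺b)
  R⇒R-quotient strong {x = x} {y = y} (same-members x'x) (same-members y'y) x'Ry' a b a∈y
               (a' , b' , aa' , a'≺b' , b'b) =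
    θ-resp-∈ x (Equivalence.to (x'x b')
      (x'Ry' a' b' (Equivalence.from (y'y a') (θ-resp-∈ y a∈y aa')) a'≺b')) b'b

  Null≺Null : Set (c ⊔ r ⊔ t)
  Null≺Null = ∀ {d} → θ d ⊥ᵇ → ∃[ e ] (d ≺ e × θ e ⊥ᵇ)

  Full≻Full : Set (c ⊔ r ⊔ t)
  Full≻Full = ∀ {d} → θ d ⊤ᵇ → ∃[ b ] (b ≺ d × θ b ⊤ᵇ)

  successor-saturated : Null≺Null → ∀ {x' x y'} → Corresponds x' x → R S _≺_ x' y' → Saturated y'
  successor-saturated null≺null {x = x} {y'} (same-members x'x) x'Ry' =
    saturated-if-no-null y' λ {d} d∈y' dθ⊥ →
    let (e , d≺e , eθ⊥) = null≺null dθ⊥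
    in Ultrafilter.⊥∉ x (θ-resp-∈ x (Equivalence.to (x'x e) (x'Ry' d e d∈y' d≺e)) eθ⊥)

  predecessor-saturated : Full≻Full → ∀ {x' x y'} → Corresponds x' x → R S _≺_ y' x' → Saturated y'
  predecessor-saturated full≻full {x = x} {y'} (same-members x'x) y'Rx' =
    saturated-if-no-null y' λ {d} d∈y' dθ⊥ →
    let (b , b≺¬d , bθ⊤) = full≻full (θ-trans (Θ.¬-cong dθ⊥) (Θ.≈⇒θ ¬⊥≈⊤))
        b∈x' = Equivalence.from (x'x b) (θ-resp-∈ x (Ultrafilter.⊤∈ x) (θ-sym bθ⊤))
    in complement∉ y' d∈y' (y'Rx' b (¬ᵇ d) b∈x' b≺¬d)

  corresponds-isBisimulation : ∀ k → (HasWhite k → Null≺Null) → (HasBlack k → Full≻Full) →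
    ∀ v → IsBisimulation {_≺_ = _≺_} {_⊏_ = quotRel k A Θ} k Corresponds v v
  IsBisimulation.atoms (corresponds-isBisimulation k _ _ v) p (same-members x'x) = x'x (v p)
  IsBisimulation.zig (corresponds-isBisimulation k null≺null _ v) h {x₁ = y'} x'x x'Ry' =
    image y' saturated , R⇒R-quotient k x'x (image-corresponds y' saturated) x'Ry'
                       , image-corresponds y' saturated
    where
      saturated : Saturated y'
      saturated = successor-saturated (null≺null h) {y' = y'} x'x x'Ry'
  IsBisimulation.zag (corresponds-isBisimulation k _ _ v) h {y₁ = y} x'x xRy =
    preimage y , R-quotient⇒R k x'x (preimage-corresponds y) xRy , preimage-corresponds y
  IsBisimulation.zig⁻ (corresponds-isBisimulation k _ full≻full v) h {x₁ = y'} x'x y'Rx' =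
    image y' saturated , R⇒R-quotient k (image-corresponds y' saturated) x'x y'Rx'
                       , image-corresponds y' saturated
    where
      saturated : Saturated y'
      saturated = predecessor-saturated (full≻full h) {y' = y'} x'x y'Rx'
  IsBisimulation.zag⁻ (corresponds-isBisimulation k _ _ v) h {y₁ = y} x'x yRx =
    preimage y , R-quotient⇒R k (preimage-corresponds y) x'x yRx , preimage-corresponds y

  module Kernel {c' ℓ' r'} {C : SubAlg c' ℓ' r'} (g : BoolHom A C)
                (kernel : ∀ a b → θ a b ⇔ SubAlg._≈_ C (BoolHom.f g a) (BoolHom.f g b)) where
    private
      module C = SubAlg C
      module CP = BooleanAlgebraProperties C.B
    open BoolHom g using (f; ⊤-hom; ⊥-hom)

    θ⊥⇔≈⊥ : ∀ d → θ d ⊥ᵇ ⇔ f d C.≈ C.⊥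
    θ⊥⇔≈⊥ d = mk⇔ (λ dθ⊥ → C.trans (Equivalence.to (kernel d ⊥ᵇ) dθ⊥) ⊥-hom)
                  (λ fd≈⊥ → Equivalence.from (kernel d ⊥ᵇ) (C.trans fd≈⊥ (C.sym ⊥-hom)))

    θ⊤⇔≈⊤ : ∀ d → θ d ⊤ᵇ ⇔ f d C.≈ C.⊤
    θ⊤⇔≈⊤ d = mk⇔ (λ dθ⊤ → C.trans (Equivalence.to (kernel d ⊤ᵇ) dθ⊤) ⊤-hom)
                  (λ fd≈⊤ → Equivalence.from (kernel d ⊤ᵇ) (C.trans fd≈⊤ (C.sym ⊤-hom)))

    condWhite⇒Null≺Null : CondWhite g → Null≺Null
    condWhite⇒Null≺Null whiteCond {d} dθ⊥ =
      let fd≈⊥ = Equivalence.to (θ⊥⇔≈⊥ d) dθ⊥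
          (e , d≺e , fe≤⊥) = whiteCond (C.≺-down (C.≺-⊥ C.⊥) (C.trans (CP.∧-zeroʳ _) (C.sym fd≈⊥)))
      in e , d≺e , Equivalence.from (θ⊥⇔≈⊥ e) (C.trans (C.sym fe≤⊥) (CP.∧-zeroʳ _))

    condBlack⇒Full≻Full : CondBlack g → Full≻Full
    condBlack⇒Full≻Full blackCond {d} dθ⊤ =
      let fd≈⊤ = Equivalence.to (θ⊤⇔≈⊤ d) dθ⊤
          (b , b≺d , ⊤≤fb) = blackCond (C.≺-up (C.≺-⊤ C.⊤) (C.trans (C.∧-congˡ fd≈⊤) (CP.∧-idem C.⊤)))
      in b , b≺d , Equivalence.from (θ⊤⇔≈⊤ b) (C.trans (C.sym (CP.∧-identityˡ _)) ⊤≤fb)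

    kernel-corresponds-isBisimulation : ∀ k → IsMorphismOf g k → ∀ v →
      IsBisimulation {_≺_ = _≺_} {_⊏_ = quotRel k A Θ} k Corresponds v v
    kernel-corresponds-isBisimulation k isMorphism = corresponds-isBisimulation k
      (λ h → condWhite⇒Null≺Null (isMorphism⇒CondWhite h isMorphism))
      (λ h → condBlack⇒Full≻Full (isMorphism⇒CondBlack h isMorphism))

proposition2p15 : ∀ {c ℓ r t c' ℓ' r'} (k : Kind) (φ : Formula k) (A : SubAlg c ℓ r)
                    (Θ : BoolCongruence A t) → IsKernelOfKind k c' ℓ' r' A Θ →
                    A ⊨ φ → A / Θ ⊨ φ
proposition2p15 k φ A Θ (_ , g , isMorphism , kernel) A⊨φ v x =
  Equivalence.to
    (⟦⟧-bisimilar (kernel-corresponds-isBisimulation k isMorphism v) φ (preimage-corresponds x))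
    (A⊨φ v (preimage x))
  where
    open Quotient A Θ
    open Kernel g kernel
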